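{- Let $t\ge0$, $0\le k\le t$, and $b_0,\dots,b_t\ge0$ be integers, and let $M=\{0^{(b_0)},1^{(b_1)},\dots,t^{(b_t)}\}$ be the multiset containing $b_i$ copies of $i$. Then the number of $k$-vn-arrangements of $M$ is \[ \binom{b_0+b_1+\dots+b_k}{b_0,b_1,\dots,b_k}\prod_{i=1}^{t-k}\binom{b_i+b_{i+1}+\dots+b_{i+k}}{b_{i+k}}. \]
   Context: Let $b=b_0+\dots+b_t$. A $k$-vn-arrangement of $M$ is an ordering $(v_1,\dots,v_b)$ of the elements of $M$ (each $i$ appearing exactly $b_i$ times) such that $v_{i+1}-v_i\le k$ for all $1\le i<b$. $\binom{m}{c_0,\dots,c_k}$ denotes the multinomial coefficient. An empty product equals $1$. -}

module Defs where

open import Data.Nat using (ℕ; zero; suc; _+_; _*_; _≤_; NonZero; _!)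
open import Data.Nat.Properties using (m*n≢0; _!≢0)
open import Data.Nat.DivMod using (_/_)
open import Data.Fin using (Fin; toℕ; _≟_)
open import Data.List using (List; length; filter; allFin)
open import Data.List.Relation.Unary.All using (All)
open import Data.List.Relation.Unary.Linked using (Linked)
open import Data.Product using (Σ; _×_)
open import Relation.Binary.PropositionalEquality using (_≡_)

sumFrom : (ℕ → ℕ) → ℕ → ℕ → ℕ
sumFrom c i zero    = 0
sumFrom c i (suc n) = c i + sumFrom c (suc i) n

prodFrom : (ℕ → ℕ) → ℕ → ℕ → ℕ
prodFrom f i zero    = 1
prodFrom f i (suc n) = f i * prodFrom f (suc i) n

prodFact-nonZero : ∀ (c : ℕ → ℕ) i n → NonZero (prodFrom (λ j → c j !) i n)
prodFact-nonZero c i zero    = _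
prodFact-nonZero c i (suc n) =
  m*n≢0 (c i !) (prodFrom (λ j → c j !) (suc i) n)
    {{c i !≢0}} {{prodFact-nonZero c (suc i) n}}

multinomial : (c : ℕ → ℕ) (k : ℕ) → ℕ
multinomial c k =
  _/_ (sumFrom c 0 (suc k) !) (prodFrom (λ j → c j !) 0 (suc k))
      {{prodFact-nonZero c 0 (suc k)}}

occ : ∀ {t} → Fin (suc t) → List (Fin (suc t)) → ℕ
occ i vs = length (filter (_≟ i) vs)

-- k-vn-arrangements of M = {0^(b 0), ..., t^(b t)}: lists over {0..t} containing
-- each i exactly b i times, with v_{j+1} - v_j ≤ k (i.e. v_{j+1} ≤ v_j + k)
-- for all consecutive entries.
VnArrangement : (t k : ℕ) (b : ℕ → ℕ) → Set
VnArrangement t k b =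
  Σ (List (Fin (suc t))) λ vs →
    All (λ i → occ i vs ≡ b (toℕ i)) (allFin (suc t))
    × Linked (λ x y → toℕ y ≤ toℕ x + k) vs

-- Deleting all copies of the largest letter m+1 from a k-vn-arrangement leaves a
-- k-vn-arrangement of {0^(b 0), …, m^(b m)}. Conversely, the b (m+1) copies of m+1 may be
-- inserted into such an arrangement at the front, after a copy of m+1, or after any letter
-- x ≥ m+1-k, and nowhere else. Stars and bars over these E + 1 gaps, where E is the number
-- of letters ≥ m+1-k, gives C(E + b (m+1), b (m+1)) extensions. Multiplying over m, the
-- first k factors telescope to the multinomial coefficient and the remaining ones are the
-- window binomials C(b_i + … + b_(i+k), b_(i+k)).
module Submission where

open import Defs
open import Data.Bool using (Bool; true; false)
open import Data.Empty using (⊥-elim)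
open import Data.Fin using (Fin; zero; suc; toℕ; fromℕ; fromℕ<; inject₁; _↑ˡ_; _↑ʳ_; splitAt; _≟_)
open import Data.Fin.Properties
  using ( toℕ<n; toℕ≤pred[n]; toℕ-fromℕ; toℕ-fromℕ<; toℕ-inject₁; toℕ-injective
        ; fromℕ≢inject₁; inject₁-injective
        ; splitAt-↑ˡ; splitAt-↑ʳ; splitAt⁻¹-↑ˡ; splitAt⁻¹-↑ʳ; *↔×)
open import Data.Fin.Relation.Unary.Top using (view; ‵fromℕ; ‵inject₁; view-fromℕ; view-inject₁)
open import Data.List using (List; []; _∷_; length; filter; head; replicate; allFin)
open import Data.List.Properties using (filter-accept; filter-reject; filter-none; filter-≐)
open import Data.List.Relation.Unary.All as All using (All; []; _∷_)
open import Data.List.Relation.Unary.All.Properties using (tabulate⁺; tabulate⁻)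
open import Data.List.Relation.Unary.Linked as Linked using (Linked; []; [-]; _∷_; head′; tail; _∷′_)
open import Data.Maybe using (just; nothing)
open import Data.Maybe.Properties using (just-injective)
open import Data.Maybe.Relation.Binary.Connected using (Connected; just; just-nothing)
open import Data.Nat using (ℕ; zero; suc; pred; _+_; _*_; _∸_; _!; _≤_; _<_; _≤?_; z≤n; z<s; s<s)
import Data.Nat as ℕ
open import Data.Nat.Combinatorics using (_C_; k>n⇒nCk≡0; nCk≡n!/k![n-k]!; k![n∸k]!∣n!; nCk+nC[k+1]≡[n+1]C[k+1])
open import Data.Nat.DivMod using (_/_; m*n/n≡m; m/n*n≡m)
open import Data.Nat.Properties
  using ( +-assoc; +-comm; +-identityʳ; +-suc; *-assoc; *-identityˡ; *-identityʳ; +-monoʳ-≤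
        ; ≤-trans; ≤-reflexive; <⇒≤; <⇒≱; <-irrefl; n<1+n; n≤1+n; m<m+n; m≤m+n; m≤n+m; 0≢1+n
        ; m≤n⇒m<n∨m≡n; m∸n≤m; m≤n+m∸n; m≤n+o⇒m∸n≤o; m≤n⇒m∸n≡0; m+[n∸m]≡n; m+n∸m≡n; m+n∸n≡m
        ; suc-injective; ≡-irrelevant; ≤-irrelevant; _!*_!≢0; module ≤-Reasoning)
open import Data.Nat.Tactic.RingSolver using (solve-∀)
open import Data.Product using (Σ; _×_; _,_; proj₁; proj₂; map₂)
import Data.Product as Product
open import Data.Product.Function.Dependent.Propositional using (Σ-↔)
open import Data.Product.Function.NonDependent.Propositional using (_×-↔_)
open import Data.Sum using (_⊎_; inj₁; inj₂; [_,_]′)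
import Data.Sum as Sum
open import Function using (_∘_; id)
open import Function.Bundles using (_↔_; mk↔ₛ′)
open import Function.Properties.Inverse using (↔-refl; ↔-sym; ↔-trans)
open import Relation.Nullary using (yes; no; does; ¬_)
open import Relation.Unary using (Decidable)
open import Relation.Binary.PropositionalEquality

occ-here : ∀ {t} (i : Fin (suc t)) vs → occ i (i ∷ vs) ≡ suc (occ i vs)
occ-here i vs = cong length (filter-accept (_≟ i) refl)

occ-there : ∀ {t} {i : Fin (suc t)} j vs → j ≢ i → occ i (j ∷ vs) ≡ occ i vs
occ-there j vs j≢i = cong length (filter-reject (_≟ _) j≢i)

-- An `Insertion p xs n` interleaves n new letters into xs, where a new letter may
-- stand only at the front (when p = true), after a new letter, or after a letter of xs
-- satisfying P.
module Insertions {A : Set} {P : A → Set} (P? : Decidable P) where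

  data Insertion : Bool → List A → ℕ → Set
  data Insertion₀ : List A → ℕ → Set

  data Insertion where
    new  : ∀ {xs n} → Insertion true xs n → Insertion true xs (suc n)
    next : ∀ {p xs n} → Insertion₀ xs n → Insertion p xs n

  data Insertion₀ where
    []  : Insertion₀ [] 0
    _∷_ : ∀ {xs n} (x : A) → Insertion (does (P? x)) xs n → Insertion₀ (x ∷ xs) n

  satisfies : ∀ {x} → true ≡ does (P? x) → P x
  satisfies {x} eq with P? x
  ... | yes px = px

  violates : ∀ {x} → false ≡ does (P? x) → ¬ P x
  violates {x} eq with P? x
  ... | no ¬px = ¬px

  #insertions : Bool → List A → ℕ → ℕ
  #insertions₀ : List A → ℕ → ℕ
  #insertions true  xs (suc n) = #insertions true xs n + #insertions₀ xs (suc n)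
  #insertions true  xs zero    = #insertions₀ xs zero
  #insertions false xs n       = #insertions₀ xs n
  #insertions₀ []       zero    = 1
  #insertions₀ []       (suc n) = 0
  #insertions₀ (x ∷ xs) n       = #insertions (does (P? x)) xs n

  toFin : ∀ {p xs n} → Insertion p xs n → Fin (#insertions p xs n)
  toFin₀ : ∀ {xs n} → Insertion₀ xs n → Fin (#insertions₀ xs n)
  toFin {true} {xs} {suc n} (new q)  = toFin q ↑ˡ #insertions₀ xs (suc n)
  toFin {true} {xs} {suc n} (next q) = #insertions true xs n ↑ʳ toFin₀ q
  toFin {true} {n = zero}   (next q) = toFin₀ q
  toFin {false}             (next q) = toFin₀ q
  toFin₀ []      = zero
  toFin₀ (x ∷ q) = toFin q

  fromFin : ∀ p xs n → Fin (#insertions p xs n) → Insertion p xs n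
  fromFin₀ : ∀ xs n → Fin (#insertions₀ xs n) → Insertion₀ xs n
  fromFin true xs (suc n) i with splitAt (#insertions true xs n) i
  ... | inj₁ j = new (fromFin true xs n j)
  ... | inj₂ j = next (fromFin₀ xs (suc n) j)
  fromFin true  xs zero i = next (fromFin₀ xs zero i)
  fromFin false xs n    i = next (fromFin₀ xs n i)
  fromFin₀ []       zero zero = []
  fromFin₀ (x ∷ xs) n    i    = x ∷ fromFin (does (P? x)) xs n i

  toFin-fromFin : ∀ p xs n i → toFin (fromFin p xs n i) ≡ i
  toFin₀-fromFin₀ : ∀ xs n i → toFin₀ (fromFin₀ xs n i) ≡ i
  toFin-fromFin true xs (suc n) i with splitAt (#insertions true xs n) i in eq
  ... | inj₁ j = trans (cong (_↑ˡ _) (toFin-fromFin true xs n j)) (splitAt⁻¹-↑ˡ eq)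
  ... | inj₂ j = trans (cong (_ ↑ʳ_) (toFin₀-fromFin₀ xs (suc n) j)) (splitAt⁻¹-↑ʳ eq)
  toFin-fromFin true  xs zero i = toFin₀-fromFin₀ xs zero i
  toFin-fromFin false xs n    i = toFin₀-fromFin₀ xs n i
  toFin₀-fromFin₀ []       zero zero = refl
  toFin₀-fromFin₀ (x ∷ xs) n    i    = toFin-fromFin (does (P? x)) xs n i

  fromFin-toFin : ∀ {p xs n} (q : Insertion p xs n) → fromFin p xs n (toFin q) ≡ q
  fromFin₀-toFin₀ : ∀ {xs n} (q : Insertion₀ xs n) → fromFin₀ xs n (toFin₀ q) ≡ q
  fromFin-toFin {true} {xs} {suc n} (new q)
    rewrite splitAt-↑ˡ (#insertions true xs n) (toFin q) (#insertions₀ xs (suc n)) =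
      cong new (fromFin-toFin q)
  fromFin-toFin {true} {xs} {suc n} (next q)
    rewrite splitAt-↑ʳ (#insertions true xs n) (#insertions₀ xs (suc n)) (toFin₀ q) =
      cong next (fromFin₀-toFin₀ q)
  fromFin-toFin {true} {n = zero} (next q) = cong next (fromFin₀-toFin₀ q)
  fromFin-toFin {false}           (next q) = cong next (fromFin₀-toFin₀ q)
  fromFin₀-toFin₀ []      = refl
  fromFin₀-toFin₀ (x ∷ q) = cong (x ∷_) (fromFin-toFin q)

  insertion↔Fin : ∀ p xs n → Insertion p xs n ↔ Fin (#insertions p xs n)
  insertion↔Fin p xs n = mk↔ₛ′ toFin (fromFin p xs n) (toFin-fromFin p xs n) fromFin-toFin

  #eligible : List A → ℕ
  #eligible xs = length (filter P? xs)

  -- Stars and bars: n new letters into the #eligible xs + 1 admissible gaps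
  -- (#eligible xs gaps for Insertion₀, where the front is excluded).
  #insertions≡ : ∀ xs n → #insertions true xs n ≡ (#eligible xs + n) C n
  #insertions₀≡ : ∀ xs n → #insertions₀ xs n ≡ pred (#eligible xs + n) C n
  #insertions≡ xs zero = #insertions₀≡ xs zero
  #insertions≡ xs (suc n) = begin
    #insertions true xs n + #insertions₀ xs (suc n)
      ≡⟨ cong₂ _+_ (#insertions≡ xs n) (#insertions₀≡ xs (suc n)) ⟩
    (E + n) C n + pred (E + suc n) C suc n
      ≡⟨ cong (λ z → (E + n) C n + pred z C suc n) (+-suc E n) ⟩
    (E + n) C n + (E + n) C suc n
      ≡⟨ nCk+nC[k+1]≡[n+1]C[k+1] (E + n) n ⟩
    suc (E + n) C suc n
      ≡⟨ cong (_C suc n) (+-suc E n) ⟨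
    (E + suc n) C suc n ∎
    where
    open ≡-Reasoning
    E = #eligible xs
  #insertions₀≡ []       zero    = refl
  #insertions₀≡ []       (suc n) = sym (k>n⇒nCk≡0 (n<1+n n))
  #insertions₀≡ (x ∷ xs) n with does (P? x)
  ... | true  = #insertions≡ xs n
  ... | false = #insertions₀≡ xs n

module _ {A : Set} {P Q R : A → Set} (P? : Decidable P) (Q? : Decidable Q) (R? : Decidable R)
         (P⇒Q⊎R : ∀ {x} → P x → Q x ⊎ R x) (Q⇒P : ∀ {x} → Q x → P x) (R⇒P : ∀ {x} → R x → P x)
         (Q⇒¬R : ∀ {x} → Q x → ¬ R x) where

  length-filter-⊎ : ∀ xs → length (filter P? xs) ≡ length (filter Q? xs) + length (filter R? xs)
  length-filter-⊎ [] = refl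
  length-filter-⊎ (x ∷ xs) with P? x | Q? x | R? x
  ... | yes _  | yes _  | no _   = cong suc (length-filter-⊎ xs)
  ... | yes _  | no _   | yes _  = trans (cong suc (length-filter-⊎ xs)) (sym (+-suc _ _))
  ... | no _   | no _   | no _   = length-filter-⊎ xs
  ... | yes px | no ¬qx | no ¬rx = ⊥-elim ([ ¬qx , ¬rx ]′ (P⇒Q⊎R px))
  ... | _      | yes qx | yes rx = ⊥-elim (Q⇒¬R qx rx)
  ... | no ¬px | yes qx | _      = ⊥-elim (¬px (Q⇒P qx))
  ... | no ¬px | _      | yes rx = ⊥-elim (¬px (R⇒P rx))

filter-≥-split : ∀ {A : Set} (f : A → ℕ) ℓ xs →
  length (filter (λ x → ℓ ≤? f x) xs)
    ≡ length (filter (λ x → f x ℕ.≟ ℓ) xs) + length (filter (λ x → suc ℓ ≤? f x) xs)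
filter-≥-split f ℓ = length-filter-⊎ _ _ _
  (Sum.map₁ sym ∘ Sum.swap ∘ m≤n⇒m<n∨m≡n) (≤-reflexive ∘ sym) <⇒≤ (λ x≡ℓ → <-irrefl (sym x≡ℓ))

module _ {m} (b : ℕ → ℕ) {xs : List (Fin (suc m))} (occ≡b : ∀ i → occ i xs ≡ b (toℕ i)) where

  #value≡b : ∀ {ℓ} → ℓ < suc m → length (filter (λ x → toℕ x ℕ.≟ ℓ) xs) ≡ b ℓ
  #value≡b ℓ<1+m = begin
    length (filter (λ x → toℕ x ℕ.≟ _) xs) ≡⟨ cong length (filter-≐ _ (_≟ i) (value⇒i , i⇒value) xs) ⟩
    occ i xs                               ≡⟨ occ≡b i ⟩
    b (toℕ i)                              ≡⟨ cong b (toℕ-fromℕ< ℓ<1+m) ⟩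
    b _                                    ∎
    where
    open ≡-Reasoning
    i = fromℕ< ℓ<1+m
    value⇒i : ∀ {x} → toℕ x ≡ _ → x ≡ i
    value⇒i x≡ℓ = toℕ-injective (trans x≡ℓ (sym (toℕ-fromℕ< ℓ<1+m)))
    i⇒value : ∀ {x} → x ≡ i → toℕ x ≡ _
    i⇒value refl = toℕ-fromℕ< ℓ<1+m

  #≥≡sumFrom : ∀ {ℓ} → ℓ ≤ suc m → length (filter (λ x → ℓ ≤? toℕ x) xs) ≡ sumFrom b ℓ (suc m ∸ ℓ)
  #≥≡sumFrom {ℓ} ℓ≤1+m = go (suc m ∸ ℓ) ℓ (m+[n∸m]≡n ℓ≤1+m)
    where
    go : ∀ d ℓ → ℓ + d ≡ suc m → length (filter (λ x → ℓ ≤? toℕ x) xs) ≡ sumFrom b ℓ d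
    go zero ℓ ℓ+0≡1+m rewrite +-identityʳ ℓ | ℓ+0≡1+m =
      cong length (filter-none (λ x → suc m ≤? toℕ x) {xs} (All.tabulate λ {x} _ → <⇒≱ (toℕ<n x)))
    go (suc d) ℓ ℓ+1+d≡1+m = trans (filter-≥-split toℕ ℓ xs) (cong₂ _+_
      (#value≡b (subst (ℓ <_) ℓ+1+d≡1+m (m<m+n ℓ z<s)))
      (go d (suc ℓ) (trans (sym (+-suc ℓ d)) ℓ+1+d≡1+m)))

sumFrom-snoc : ∀ c i n → sumFrom c i (suc n) ≡ sumFrom c i n + c (i + n)
sumFrom-snoc c i zero    = trans (+-identityʳ (c i)) (cong c (sym (+-identityʳ i)))
sumFrom-snoc c i (suc n) = begin
  c i + sumFrom c (suc i) (suc n)          ≡⟨ cong (c i +_) (sumFrom-snoc c (suc i) n) ⟩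
  c i + (sumFrom c (suc i) n + c (suc i + n)) ≡⟨ +-assoc (c i) _ _ ⟨
  sumFrom c i (suc n) + c (suc i + n)      ≡⟨ cong (λ j → sumFrom c i (suc n) + c j) (+-suc i n) ⟨
  sumFrom c i (suc n) + c (i + suc n)      ∎
  where open ≡-Reasoning

prodFrom-+ : ∀ f i m n → prodFrom f i (m + n) ≡ prodFrom f i m * prodFrom f (i + m) n
prodFrom-+ f i zero    n = sym (trans (*-identityˡ _) (cong (λ j → prodFrom f j n) (+-identityʳ i)))
prodFrom-+ f i (suc m) n = begin
  f i * prodFrom f (suc i) (m + n)                         ≡⟨ cong (f i *_) (prodFrom-+ f (suc i) m n) ⟩
  f i * (prodFrom f (suc i) m * prodFrom f (suc i + m) n)  ≡⟨ *-assoc (f i) _ _ ⟨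
  prodFrom f i (suc m) * prodFrom f (suc i + m) n          ≡⟨ cong (λ j → prodFrom f i (suc m) * prodFrom f j n) (+-suc i m) ⟨
  prodFrom f i (suc m) * prodFrom f (i + suc m) n          ∎
  where open ≡-Reasoning

prodFrom-snoc : ∀ f i n → prodFrom f i (suc n) ≡ prodFrom f i n * f (i + n)
prodFrom-snoc f i n = begin
  prodFrom f i (suc n)             ≡⟨ cong (prodFrom f i) (+-comm 1 n) ⟩
  prodFrom f i (n + 1)             ≡⟨ prodFrom-+ f i n 1 ⟩
  prodFrom f i n * (f (i + n) * 1) ≡⟨ cong (prodFrom f i n *_) (*-identityʳ _) ⟩
  prodFrom f i n * f (i + n)       ∎
  where open ≡-Reasoning

prodFrom-cong : ∀ {f g} i i′ n → (∀ j → j < n → f (i + j) ≡ g (i′ + j)) → prodFrom f i n ≡ prodFrom g i′ n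
prodFrom-cong i i′ zero    _ = refl
prodFrom-cong {f} {g} i i′ (suc n) f≡g = cong₂ _*_
  (subst₂ (λ a a′ → f a ≡ g a′) (+-identityʳ i) (+-identityʳ i′) (f≡g 0 z<s))
  (prodFrom-cong (suc i) (suc i′) n λ j j<n →
    subst₂ (λ a a′ → f a ≡ g a′) (+-suc i j) (+-suc i′ j) (f≡g (suc j) (s<s j<n)))

[m+n]Cn*n!*m!≡[m+n]! : ∀ m n → ((m + n) C n) * (n ! * m !) ≡ (m + n) !
[m+n]Cn*n!*m!≡[m+n]! m n = begin
  ((m + n) C n) * (n ! * m !)
    ≡⟨ cong (λ j → ((m + n) C n) * (n ! * j !)) (m+n∸n≡m m n) ⟨
  ((m + n) C n) * (n ! * (m + n ∸ n) !)
    ≡⟨ cong (_* (n ! * (m + n ∸ n) !)) (nCk≡n!/k![n-k]! n≤m+n) ⟩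
  ((m + n) ! / (n ! * (m + n ∸ n) !)) {{n !* (m + n ∸ n) !≢0}} * (n ! * (m + n ∸ n) !)
    ≡⟨ m/n*n≡m {{n !* (m + n ∸ n) !≢0}} (k![n∸k]!∣n! n≤m+n) ⟩
  (m + n) ! ∎
  where
  open ≡-Reasoning
  n≤m+n : n ≤ m + n
  n≤m+n = m≤n+m n m

multinomialFactor : (ℕ → ℕ) → ℕ → ℕ
multinomialFactor c j = (sumFrom c 0 (suc j) + c (suc j)) C c (suc j)

∏multinomialFactor*∏!≡[Σ]! : ∀ c m →
  prodFrom (multinomialFactor c) 0 m * prodFrom (λ j → c j !) 0 (suc m) ≡ sumFrom c 0 (suc m) !
∏multinomialFactor*∏!≡[Σ]! c zero = trans (*-identityˡ _) (trans (*-identityʳ _) (cong _! (sym (+-identityʳ (c 0)))))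
∏multinomialFactor*∏!≡[Σ]! c (suc m) = begin
  P (suc m) * F (suc m)
    ≡⟨ cong₂ _*_ (prodFrom-snoc (multinomialFactor c) 0 m) (prodFrom-snoc (λ j → c j !) 0 (suc m)) ⟩
  P m * multinomialFactor c m * (F m * c (suc m) !)
    ≡⟨ regroup (P m) (multinomialFactor c m) (F m) (c (suc m) !) ⟩
  multinomialFactor c m * (c (suc m) ! * (P m * F m))
    ≡⟨ cong (λ z → multinomialFactor c m * (c (suc m) ! * z)) (∏multinomialFactor*∏!≡[Σ]! c m) ⟩
  multinomialFactor c m * (c (suc m) ! * sumFrom c 0 (suc m) !)
    ≡⟨ [m+n]Cn*n!*m!≡[m+n]! (sumFrom c 0 (suc m)) (c (suc m)) ⟩
  (sumFrom c 0 (suc m) + c (suc m)) !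
    ≡⟨ cong _! (sumFrom-snoc c 0 (suc m)) ⟨
  sumFrom c 0 (suc (suc m)) ! ∎
  where
  open ≡-Reasoning
  P = prodFrom (multinomialFactor c) 0
  F = λ m → prodFrom (λ j → c j !) 0 (suc m)
  regroup : ∀ p q f x → p * q * (f * x) ≡ q * (x * (p * f))
  regroup = solve-∀

multinomial≡prodFrom : ∀ c m → multinomial c m ≡ prodFrom (multinomialFactor c) 0 m
multinomial≡prodFrom c m = begin
  multinomial c m
    ≡⟨ cong (λ z → (z / F) {{prodFact-nonZero c 0 (suc m)}}) (∏multinomialFactor*∏!≡[Σ]! c m) ⟨
  ((P * F) / F) {{prodFact-nonZero c 0 (suc m)}}
    ≡⟨ m*n/n≡m P F {{prodFact-nonZero c 0 (suc m)}} ⟩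
  P ∎
  where
  open ≡-Reasoning
  P = prodFrom (multinomialFactor c) 0 m
  F = prodFrom (λ j → c j !) 0 (suc m)

RiseAtMost : ℕ → ∀ {n} → Fin n → Fin n → Set
RiseAtMost k x y = toℕ y ≤ toℕ x + k

connected-to-all : ∀ {A : Set} {R : A → A → Set} {x} {y?} → (∀ y → R x y) → Connected R (just x) y?
connected-to-all {y? = nothing} _     = just-nothing
connected-to-all {y? = just y}  Rx- = just (Rx- y)

arrangement-≡ : ∀ {t k b} {a a′ : VnArrangement t k b} → proj₁ a ≡ proj₁ a′ → a ≡ a′
arrangement-≡ {a = vs , c , l} {.vs , c′ , l′} refl =
  cong₂ (λ c l → vs , c , l) (All.irrelevant ≡-irrelevant c c′) (Linked.irrelevant ≤-irrelevant l l′)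

module Extension (k m : ℕ) where

  top : Fin (suc (suc m))
  top = fromℕ (suc m)

  _↝_ : ∀ {n} → Fin n → Fin n → Set
  _↝_ = RiseAtMost k

  Eligible : Fin (suc m) → Set
  Eligible x = suc m ∸ k ≤ toℕ x

  eligible? : Decidable Eligible
  eligible? x = suc m ∸ k ≤? toℕ x

  open Insertions eligible? public

  eligible⇒1+m≤ : ∀ {x} → Eligible x → suc m ≤ toℕ x + k
  eligible⇒1+m≤ {x} e = begin
    suc m               ≤⟨ m≤n+m∸n (suc m) k ⟩
    k + (suc m ∸ k)     ≤⟨ +-monoʳ-≤ k e ⟩
    k + toℕ x           ≡⟨ +-comm k (toℕ x) ⟩
    toℕ x + k           ∎
    where open ≤-Reasoning

  eligible⇒↝top : ∀ {x} → Eligible x → inject₁ x ↝ top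
  eligible⇒↝top {x} e =
    subst₂ _≤_ (sym (toℕ-fromℕ (suc m))) (cong (_+ k) (sym (toℕ-inject₁ x))) (eligible⇒1+m≤ e)

  ↝top⇒eligible : ∀ {x} → inject₁ x ↝ top → Eligible x
  ↝top⇒eligible {x} x↝top = m≤n+o⇒m∸n≤o (suc m) k
    (subst₂ _≤_ (toℕ-fromℕ (suc m)) (trans (cong (_+ k) (toℕ-inject₁ x)) (+-comm (toℕ x) k)) x↝top)

  eligible⇒↝ : ∀ {x} → Eligible x → ∀ y → x ↝ y
  eligible⇒↝ e y = ≤-trans (≤-trans (toℕ≤pred[n] y) (n≤1+n m)) (eligible⇒1+m≤ e)

  top↝ : ∀ y → top ↝ y
  top↝ y = ≤-trans (toℕ≤pred[n] y) (≤-trans (≤-reflexive (sym (toℕ-fromℕ (suc m)))) (m≤m+n _ k))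

  inject₁-↝ : ∀ {x y : Fin (suc m)} → x ↝ y → inject₁ x ↝ inject₁ y
  inject₁-↝ {x} {y} = subst₂ _≤_ (sym (toℕ-inject₁ y)) (cong (_+ k) (sym (toℕ-inject₁ x)))

  inject₁-↝⁻ : ∀ {x y : Fin (suc m)} → inject₁ x ↝ inject₁ y → x ↝ y
  inject₁-↝⁻ {x} {y} = subst₂ _≤_ (toℕ-inject₁ y) (cong (_+ k) (toℕ-inject₁ x))

  render : ∀ {p xs n} → Insertion p xs n → List (Fin (suc (suc m)))
  render₀ : ∀ {xs n} → Insertion₀ xs n → List (Fin (suc (suc m)))
  render (new q)  = top ∷ render q
  render (next q) = render₀ q
  render₀ []      = []
  render₀ (x ∷ q) = inject₁ x ∷ render q

  occ-top-render : ∀ {p xs n} (q : Insertion p xs n) → occ top (render q) ≡ n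
  occ-top-render (new q)        = trans (occ-here top (render q)) (cong suc (occ-top-render q))
  occ-top-render (next [])      = refl
  occ-top-render (next (x ∷ q)) = trans (occ-there (inject₁ x) (render q) (fromℕ≢inject₁ ∘ sym)) (occ-top-render q)

  occ-inject₁-render : ∀ {p xs n} (q : Insertion p xs n) i → occ (inject₁ i) (render q) ≡ occ i xs
  occ-inject₁-render (new q)   i = trans (occ-there top (render q) fromℕ≢inject₁) (occ-inject₁-render q i)
  occ-inject₁-render (next []) i = refl
  occ-inject₁-render (next (x ∷ q)) i with x ≟ i
  ... | yes refl = trans (occ-here (inject₁ x) (render q)) (cong suc (occ-inject₁-render q x))
  ... | no x≢i   = trans (occ-there (inject₁ x) (render q) (x≢i ∘ inject₁-injective)) (occ-inject₁-render q i)

  render-connected : ∀ {x p xs n} → p ≡ does (eligible? x) → (q : Insertion p xs n) →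
    Connected _↝_ (just x) (head xs) → Connected _↝_ (just (inject₁ x)) (head (render q))
  render-connected p≡ (new q)        _        = just (eligible⇒↝top (satisfies p≡))
  render-connected _  (next [])      _        = just-nothing
  render-connected _  (next (y ∷ q)) (just r) = just (inject₁-↝ r)

  render-connected⁻ : ∀ {x p xs n} → p ≡ does (eligible? x) → (q : Insertion p xs n) →
    Connected _↝_ (just (inject₁ x)) (head (render q)) → Connected _↝_ (just x) (head xs)
  render-connected⁻ p≡ (new q)        _        = connected-to-all (eligible⇒↝ (satisfies p≡))
  render-connected⁻ _  (next [])      _        = just-nothing
  render-connected⁻ _  (next (y ∷ q)) (just r) = just (inject₁-↝⁻ r)

  linked-render : ∀ {p xs n} (q : Insertion p xs n) → Linked _↝_ xs → Linked _↝_ (render q)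
  linked-render (new q)        l = connected-to-all top↝ ∷′ linked-render q l
  linked-render (next [])      _ = []
  linked-render (next (x ∷ q)) l = render-connected refl q (head′ l) ∷′ linked-render q (tail l)

  linked-render⁻ : ∀ {p xs n} (q : Insertion p xs n) → Linked _↝_ (render q) → Linked _↝_ xs
  linked-render⁻ (new q)        l = linked-render⁻ q (tail l)
  linked-render⁻ (next [])      _ = []
  linked-render⁻ (next (x ∷ q)) l = render-connected⁻ refl q (head′ l) ∷′ linked-render⁻ q (tail l)

  TopAllowed : Bool → List (Fin (suc (suc m))) → Set
  TopAllowed p ys = p ≡ false → head ys ≢ just top

  top-allowed : ∀ x ys → Connected _↝_ (just (inject₁ x)) (head ys) → TopAllowed (does (eligible? x)) ys
  top-allowed x []       _        _           ()
  top-allowed x (y ∷ ys) (just r) does≡false y≡top =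
    violates (sym does≡false) (↝top⇒eligible (subst (inject₁ x ↝_) (just-injective y≡top) r))

  parse : ∀ p ys → Linked _↝_ ys → TopAllowed p ys → ∀ n → occ top ys ≡ n →
          Σ (List (Fin (suc m))) λ xs → Insertion p xs n
  parse p [] _ _ zero _ = [] , next []
  parse p (y ∷ ys) l ok n occ≡n with view y
  parse false (y ∷ ys) l ok n       occ≡n | ‵fromℕ = ⊥-elim (ok refl refl)
  parse true  (y ∷ ys) l ok zero    occ≡n | ‵fromℕ = ⊥-elim (0≢1+n (trans (sym occ≡n) (occ-here top ys)))
  parse true  (y ∷ ys) l ok (suc n) occ≡n | ‵fromℕ =
    map₂ new (parse true ys (tail l) (λ ()) n (suc-injective (trans (sym (occ-here top ys)) occ≡n)))
  parse p (y ∷ ys) l ok n occ≡n | ‵inject₁ x =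
    Product.map (x ∷_) (next ∘ (x ∷_))
      (parse _ ys (tail l) (top-allowed x ys (head′ l)) n
        (trans (sym (occ-there (inject₁ x) ys (fromℕ≢inject₁ ∘ sym))) occ≡n))

  render-parse : ∀ p ys l ok n occ≡n → render (proj₂ (parse p ys l ok n occ≡n)) ≡ ys
  render-parse p [] _ _ zero _ = refl
  render-parse p (y ∷ ys) l ok n occ≡n with view y
  render-parse false (y ∷ ys) l ok n       occ≡n | ‵fromℕ = ⊥-elim (ok refl refl)
  render-parse true  (y ∷ ys) l ok zero    occ≡n | ‵fromℕ = ⊥-elim (0≢1+n (trans (sym occ≡n) (occ-here top ys)))
  render-parse true  (y ∷ ys) l ok (suc n) occ≡n | ‵fromℕ = cong (top ∷_) (render-parse true ys _ _ n _)
  render-parse p (y ∷ ys) l ok n occ≡n | ‵inject₁ x = cong (inject₁ x ∷_) (render-parse _ ys _ _ n _)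

  parse-render : ∀ {p xs n} (q : Insertion p xs n) l ok occ≡n → parse p (render q) l ok n occ≡n ≡ (xs , q)
  parse-render (new q) l ok occ≡n rewrite view-fromℕ (suc m) = cong (map₂ new) (parse-render q _ _ _)
  parse-render (next []) _ _ _ = refl
  parse-render (next (x ∷ q)) l ok occ≡n rewrite view-inject₁ x =
    cong (Product.map (x ∷_) (next ∘ (x ∷_))) (parse-render q _ _ _)

  module _ (b : ℕ → ℕ) where

    Extensions : VnArrangement m k b → Set
    Extensions a = Insertion true (proj₁ a) (b (suc m))

    occ-top≡ : ∀ ys → All (λ i → occ i ys ≡ b (toℕ i)) (allFin (suc (suc m))) → occ top ys ≡ b (suc m)
    occ-top≡ ys c = trans (tabulate⁻ {f = id} c top) (cong b (toℕ-fromℕ (suc m)))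

    restrict : VnArrangement (suc m) k b → Σ (VnArrangement m k b) Extensions
    restrict (ys , c , l) =
      (xs , tabulate⁺ {f = id} occ≡b , linked-render⁻ q (subst (Linked _↝_) (sym render-q≡ys) l)) , q
      where
      xs = proj₁ (parse true ys l (λ ()) (b (suc m)) (occ-top≡ ys c))
      q  = proj₂ (parse true ys l (λ ()) (b (suc m)) (occ-top≡ ys c))
      render-q≡ys : render q ≡ ys
      render-q≡ys = render-parse true ys l (λ ()) (b (suc m)) (occ-top≡ ys c)
      occ≡b : ∀ i → occ i xs ≡ b (toℕ i)
      occ≡b i = begin
        occ i xs                   ≡⟨ occ-inject₁-render q i ⟨
        occ (inject₁ i) (render q) ≡⟨ cong (occ (inject₁ i)) render-q≡ys ⟩
        occ (inject₁ i) ys         ≡⟨ tabulate⁻ {f = id} c (inject₁ i) ⟩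
        b (toℕ (inject₁ i))        ≡⟨ cong b (toℕ-inject₁ i) ⟩
        b (toℕ i)                  ∎
        where open ≡-Reasoning

    extend : Σ (VnArrangement m k b) Extensions → VnArrangement (suc m) k b
    extend ((xs , c , l) , q) = render q , tabulate⁺ {f = id} occ≡b , linked-render q l
      where
      occ≡b : ∀ i → occ i (render q) ≡ b (toℕ i)
      occ≡b i with view i
      ... | ‵fromℕ     = trans (occ-top-render q) (cong b (sym (toℕ-fromℕ (suc m))))
      ... | ‵inject₁ j = trans (occ-inject₁-render q j) (trans (tabulate⁻ {f = id} c j) (cong b (sym (toℕ-inject₁ j))))

    extension-≡ : {e e′ : Σ (VnArrangement m k b) Extensions} →
                  _≡_ {A = Σ (List (Fin (suc m))) (λ xs → Insertion true xs (b (suc m)))}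
                    (proj₁ (proj₁ e) , proj₂ e) (proj₁ (proj₁ e′) , proj₂ e′) → e ≡ e′
    extension-≡ {(xs , c , l) , q} {(.xs , c′ , l′) , .q} refl =
      cong₂ (λ c l → (xs , c , l) , q) (All.irrelevant ≡-irrelevant c c′) (Linked.irrelevant ≤-irrelevant l l′)

    restrict↔ : VnArrangement (suc m) k b ↔ Σ (VnArrangement m k b) Extensions
    restrict↔ = mk↔ₛ′ restrict extend
      (λ { ((xs , c , l) , q) → extension-≡ (parse-render q _ _ _) })
      (λ { (ys , c , l) → arrangement-≡ {b = b} (render-parse true ys l (λ ()) (b (suc m)) (occ-top≡ ys c)) })

-- The window sum runs over the letters m+1-k, …, m (from 0 when m+1 < k); these are the
-- letters that m+1 may follow.
#extensions : ℕ → (ℕ → ℕ) → ℕ → ℕ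
#extensions k b m = (sumFrom b (suc m ∸ k) (suc m ∸ (suc m ∸ k)) + b (suc m)) C b (suc m)

extension↔ : ∀ k b m → VnArrangement (suc m) k b ↔ (VnArrangement m k b × Fin (#extensions k b m))
extension↔ k b m = ↔-trans (restrict↔ b) (Σ-↔ ↔-refl λ {a} →
  subst (λ N → Extensions b a ↔ Fin N) (#insertions≡#extensions a) (insertion↔Fin true (proj₁ a) (b (suc m))))
  where
  open Extension k m
  #insertions≡#extensions : ∀ a → #insertions true (proj₁ a) (b (suc m)) ≡ #extensions k b m
  #insertions≡#extensions (xs , c , _) = trans (#insertions≡ xs (b (suc m)))
    (cong (λ E → (E + b (suc m)) C b (suc m)) (#≥≡sumFrom b {xs} (tabulate⁻ {f = id} c) (m∸n≤m (suc m) k)))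

linked-replicate : ∀ {A : Set} {R : A → A → Set} {x} → R x x → ∀ n → Linked R (replicate n x)
linked-replicate Rxx zero          = []
linked-replicate Rxx (suc zero)    = [-]
linked-replicate Rxx (suc (suc n)) = Rxx ∷ linked-replicate Rxx (suc n)

occ-replicate : ∀ n → occ zero (replicate n (zero {0})) ≡ n
occ-replicate zero    = refl
occ-replicate (suc n) = cong suc (occ-replicate n)

≡replicate-occ : ∀ (vs : List (Fin 1)) → vs ≡ replicate (occ zero vs) zero
≡replicate-occ []          = refl
≡replicate-occ (zero ∷ vs) = cong (zero ∷_) (≡replicate-occ vs)

arrangement₀↔ : ∀ k b → VnArrangement 0 k b ↔ Fin 1
arrangement₀↔ k b = mk↔ₛ′ (λ _ → zero) (λ _ → the-arrangement) (λ { zero → refl })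
  λ { (vs , c , _) → arrangement-≡ {b = b} (trans (cong (λ n → replicate n zero) (sym (tabulate⁻ {f = id} c zero)))
                                                   (sym (≡replicate-occ vs))) }
  where
  the-arrangement : VnArrangement 0 k b
  the-arrangement = replicate (b 0) zero , occ-replicate (b 0) ∷ [] , linked-replicate z≤n (b 0)

arrangements↔ : ∀ k b t → VnArrangement t k b ↔ Fin (prodFrom (#extensions k b) 0 t)
arrangements↔ k b zero    = arrangement₀↔ k b
arrangements↔ k b (suc m) = subst (λ N → VnArrangement (suc m) k b ↔ Fin N) (sym (prodFrom-snoc _ 0 m))
  (↔-trans (extension↔ k b m) (↔-trans (arrangements↔ k b m ×-↔ ↔-refl) (↔-sym *↔×)))

#extensions-below : ∀ {k} b {j} → j < k → #extensions k b j ≡ multinomialFactor b j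
#extensions-below b j<k rewrite m≤n⇒m∸n≡0 j<k = refl

#extensions-above : ∀ k b d → #extensions k b (k + d) ≡ sumFrom b (suc d) (suc k) C b (suc d + k)
#extensions-above k b d = begin
  (sumFrom b (suc (k + d) ∸ k) (suc (k + d) ∸ (suc (k + d) ∸ k)) + b (suc (k + d))) C b (suc (k + d))
    ≡⟨ cong (λ i → (sumFrom b i (suc (k + d) ∸ i) + b (suc (k + d))) C b (suc (k + d))) 1+k+d∸k≡1+d ⟩
  (sumFrom b (suc d) (k + d ∸ d) + b (suc (k + d))) C b (suc (k + d))
    ≡⟨ cong₂ (λ n j → (sumFrom b (suc d) n + b j) C b j) (m+n∸n≡m k d) (cong suc (+-comm k d)) ⟩
  (sumFrom b (suc d) k + b (suc d + k)) C b (suc d + k)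
    ≡⟨ cong (_C b (suc d + k)) (sumFrom-snoc b (suc d) k) ⟨
  sumFrom b (suc d) (suc k) C b (suc d + k) ∎
  where
  open ≡-Reasoning
  1+k+d∸k≡1+d : suc (k + d) ∸ k ≡ suc d
  1+k+d∸k≡1+d = trans (cong (_∸ k) (sym (+-suc k d))) (m+n∸m≡n k (suc d))

#arrangements≡ : ∀ k b t → k ≤ t →
  prodFrom (#extensions k b) 0 t ≡ multinomial b k * prodFrom (λ i → sumFrom b i (suc k) C b (i + k)) 1 (t ∸ k)
#arrangements≡ k b t k≤t = begin
  prodFrom (#extensions k b) 0 t
    ≡⟨ cong (prodFrom (#extensions k b) 0) (m+[n∸m]≡n k≤t) ⟨
  prodFrom (#extensions k b) 0 (k + (t ∸ k))
    ≡⟨ prodFrom-+ (#extensions k b) 0 k (t ∸ k) ⟩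
  prodFrom (#extensions k b) 0 k * prodFrom (#extensions k b) k (t ∸ k)
    ≡⟨ cong₂ _*_ (prodFrom-cong 0 0 k λ j → #extensions-below b) (prodFrom-cong k 1 (t ∸ k) λ j _ → #extensions-above k b j) ⟩
  prodFrom (multinomialFactor b) 0 k * windows
    ≡⟨ cong (_* windows) (multinomial≡prodFrom b k) ⟨
  multinomial b k * windows ∎
  where
  open ≡-Reasoning
  windows = prodFrom (λ i → sumFrom b i (suc k) C b (i + k)) 1 (t ∸ k)

proposition4p3 : (t k : ℕ) → k ≤ t → (b : ℕ → ℕ) →
    Fin (multinomial b k
         * prodFrom (λ i → sumFrom b i (suc k) C b (i + k)) 1 (t ∸ k))
      ↔ VnArrangement t k b
proposition4p3 t k k≤t b =
  ↔-sym (subst (λ N → VnArrangement t k b ↔ Fin N) (#arrangements≡ k b t k≤t) (arrangements↔ k b t))
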